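{- Let $p$ be an odd prime and $i\geq1$. Let $a,b\in p\mathbb{Z}_p$ and $u\in\mathbb{Z}_p^\times$. Then each of the maps $\mu\mapsto\mu^{ -1}+a\mu$ and $\mu\mapsto\dfrac{a\mu^2+2u\mu}{a\mu+u}$ from $\mathbb{Z}_p^\times$ to $\mathbb{Z}_p^\times$ descends to a bijection $\mathbb{Z}_p^\times/(1+p^i\mathbb{Z}_p)\to\mathbb{Z}_p^\times/(1+p^i\mathbb{Z}_p)$. -}

module Defs where

open import Data.Nat using (ℕ; zero; suc; _+_; _*_; _∸_; _^_; ∣_-_∣)
open import Data.Nat.Divisibility using (_∣_)
open import Data.Nat.GCD using (module Bézout)
open import Data.Product using (Σ; _×_; _,_; ∃)

-- p-adic integers ℤ_p as the inverse limit  lim ℤ/pⁿ.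
--
-- An element is represented by a sequence x : ℕ → ℕ where x n is a
-- representative of the residue of the element modulo pⁿ, subject to the
-- compatibility condition x (n+1) ≡ x n (mod pⁿ).  Two representing
-- sequences denote the same p-adic integer iff x n ≡ y n (mod pⁿ) for
-- all n.  (Every element of ℤ_p has such non-negative representatives.)

Seq : Set
Seq = ℕ → ℕ

_≡_[mod_] : ℕ → ℕ → ℕ → Set
x ≡ y [mod m ] = m ∣ ∣ x - y ∣

IsZp : ℕ → Seq → Set
IsZp p x = ∀ n → x (suc n) ≡ x n [mod p ^ n ]

_≈⟨_⟩_ : Seq → ℕ → Seq → Set
x ≈⟨ p ⟩ y = ∀ n → x n ≡ y n [mod p ^ n ]

const : ℕ → Seq
const k n = k

infixl 6 _+ₚ_
infixl 7 _*ₚ_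

_+ₚ_ : Seq → Seq → Seq
(x +ₚ y) n = x n + y n

_*ₚ_ : Seq → Seq → Seq
(x *ₚ y) n = x n * y n

-- Modular inverse of m modulo N, computed via Bézout's identity
-- (extended Euclid from the standard library).  When gcd m N = 1 this
-- satisfies m * invMod m N ≡ 1 (mod N).
invMod : ℕ → ℕ → ℕ
invMod m N with Bézout.lemma m N
... | Bézout.result d g (Bézout.+- x y eq) = x
... | Bézout.result d g (Bézout.-+ x y eq) = x * (N ∸ 1)

-- Inverse in ℤ_p: levelwise inverse modulo pⁿ (meaningful for units).
inv : ℕ → Seq → Seq
inv p x n = invMod (x n) (p ^ n)

div : ℕ → Seq → Seq → Seq
div p y x = y *ₚ inv p x

IsUnit : ℕ → Seq → Set
IsUnit p x = IsZp p x × Σ Seq (λ y → IsZp p y × ((x *ₚ y) ≈⟨ p ⟩ const 1))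

InPZp : ℕ → Seq → Set
InPZp p a = IsZp p a × Σ Seq (λ c → IsZp p c × (a ≈⟨ p ⟩ (const p *ₚ c)))

SameCoset : ℕ → ℕ → Seq → Seq → Set
SameCoset p i μ ν = Σ Seq (λ z → IsZp p z × (μ ≈⟨ p ⟩ (ν *ₚ (const 1 +ₚ const (p ^ i) *ₚ z))))

-- A map f : ℤ_p^× → ℤ_p^× descends to a bijection of
-- ℤ_p^× / (1 + pⁱ ℤ_p) onto itself:
--   * f maps units to units,
--   * f respects the coset relation (so the induced map is well defined;
--     this includes independence of the chosen representing sequence),
--   * the induced map is injective,
--   * the induced map is surjective.
DescendsToBijection : ℕ → ℕ → (Seq → Seq) → Set
DescendsToBijection p i f =
    (∀ μ → IsUnit p μ → IsUnit p (f μ))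
  × (∀ μ ν → IsUnit p μ → IsUnit p ν → SameCoset p i μ ν → SameCoset p i (f μ) (f ν))
  × (∀ μ ν → IsUnit p μ → IsUnit p ν → SameCoset p i (f μ) (f ν) → SameCoset p i μ ν)
  × (∀ ν → IsUnit p ν → Σ Seq (λ μ → IsUnit p μ × SameCoset p i (f μ) ν))

map₁ : ℕ → Seq → Seq → Seq
map₁ p a μ = inv p μ +ₚ a *ₚ μ

map₂ : ℕ → Seq → Seq → Seq → Seq
map₂ p a u μ = div p (a *ₚ μ *ₚ μ +ₚ const 2 *ₚ u *ₚ μ) (a *ₚ μ +ₚ u)

-- Both maps are computed levelwise: at level n they act on the residue of μ modulo pⁿ
-- by an explicit map F n on ℕ.  Two units lie in the same coset of 1 + pⁱℤₚ exactly
-- when their residues modulo pⁱ agree, so the theorem reduces to F i being well defined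
-- and injective on the units of ℤ/pⁱ; surjectivity then follows because ℤ/pⁱ is finite.
-- Injectivity comes from clearing denominators:
--   (μ⁻¹ + a μ) - (ν⁻¹ + a ν) = (μ - ν) (a μ ν - 1) / (μ ν),
--   (a μ² + 2 u μ) / (a μ + u) - (a ν² + 2 u ν) / (a ν + u)
--     = (μ - ν) (a² μ ν + a u (μ + ν) + 2 u²) / ((a μ + u) (a ν + u)),
-- and the second factors are units since a ≡ 0 modulo p while 2 and u are units.
module Submission where

open import Algebra using (CommutativeRing; CommutativeMonoid)
open import Data.Empty using (⊥-elim)
open import Data.Fin as Fin using (Fin; toℕ)
import Data.Fin.Properties as Fin
open import Data.Integer using (ℤ; +_; 0ℤ; 1ℤ; _+_; _*_; -_; _-_; _⊖_; ∣_∣)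
import Data.Integer.Properties as ℤ
open import Data.Integer.Divisibility.Signed
  using ( _∣_; divides; ∣ᵤ⇒∣; ∣⇒∣ᵤ; ∣-trans; ∣m∣n⇒∣m+n; ∣m∣n⇒∣m-n; ∣m⇒∣-m; ∣m⇒∣m*n; ∣n⇒∣m*n
        ; *-monoˡ-∣; *-monoʳ-∣)
open import Data.Integer.Tactic.RingSolver using (solve-∀; solve)
open import Data.List using (_∷_; [])
open import Data.Nat as ℕ using (ℕ; zero; suc; _^_; _∸_; _≤_; _<_)
import Data.Nat.Properties as ℕ
open import Data.Nat.Coprimality as Coprime using (Coprime; coprime?)
open import Data.Nat.Divisibility using () renaming (_∣_ to _ℕ∣_)
import Data.Nat.Divisibility as ℕ
open import Data.Nat.DivMod using (_%_; _/_; _mod_; m≡m%n+[m/n]*n; m%n≤m; m%n<n)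
open import Data.Nat.GCD using (module Bézout; module GCD)
open import Data.Nat.Primality using (Prime; prime⇒nonTrivial; prime⇒nonZero)
open import Data.Product using (_,_; _×_; ∃; proj₁; proj₂)
open import Function using (_∘_)
open import Function.Definitions using (Injective; StrictlySurjective)
open import Level using (0ℓ; _⊔_)
open import Relation.Binary.PropositionalEquality as ≡ using (_≡_; _≢_; refl)
open import Relation.Binary.Structures using (IsEquivalence)
open import Relation.Nullary using (Dec; yes; no; map′)
open import Algebra.Properties.CommutativeSemigroup ℤ.*-commutativeSemigroup using (x∙yz≈y∙xz)

open import Defs hiding (_≈⟨_⟩_)

infix 4 _≡ᶻ_[mod_]

-- A record rather than a definition, so that x, y and N can be inferred from the type.
record _≡ᶻ_[mod_] (x y : ℤ) (N : ℕ) : Set where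
  constructor ∣⇒≡ᶻ
  field ≡ᶻ⇒∣ : + N ∣ x - y

module _ {N : ℕ} where

  ∣-difference : ∀ {d x y} → + N ∣ d → d ≡ x - y → x ≡ᶻ y [mod N ]
  ∣-difference N∣d refl = ∣⇒≡ᶻ N∣d

  ≡⇒≡ᶻ : ∀ {x y} → x ≡ y → x ≡ᶻ y [mod N ]
  ≡⇒≡ᶻ {x} refl = ∣⇒≡ᶻ (divides 0ℤ (ℤ.+-inverseʳ x))

  ≡ᶻ-refl : ∀ {x} → x ≡ᶻ x [mod N ]
  ≡ᶻ-refl = ≡⇒≡ᶻ refl

  ≡ᶻ-sym : ∀ {x y} → x ≡ᶻ y [mod N ] → y ≡ᶻ x [mod N ]
  ≡ᶻ-sym {x} {y} (∣⇒≡ᶻ N∣x-y) = ∣-difference (∣m⇒∣-m N∣x-y) (lemma x y)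
    where lemma : ∀ x y → - (x - y) ≡ y - x
          lemma = solve-∀

  ≡ᶻ-trans : ∀ {x y z} → x ≡ᶻ y [mod N ] → y ≡ᶻ z [mod N ] → x ≡ᶻ z [mod N ]
  ≡ᶻ-trans {x} {y} {z} (∣⇒≡ᶻ N∣x-y) (∣⇒≡ᶻ N∣y-z) =
    ∣-difference (∣m∣n⇒∣m+n N∣x-y N∣y-z) (lemma x y z)
    where lemma : ∀ x y z → (x - y) + (y - z) ≡ x - z
          lemma = solve-∀

  ≡ᶻ-isEquivalence : IsEquivalence _≡ᶻ_[mod N ]
  ≡ᶻ-isEquivalence = record { refl = ≡ᶻ-refl ; sym = ≡ᶻ-sym ; trans = ≡ᶻ-trans }

  +-cong-mod : ∀ {x y u v} → x ≡ᶻ y [mod N ] → u ≡ᶻ v [mod N ] → x + u ≡ᶻ y + v [mod N ]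
  +-cong-mod {x} {y} {u} {v} (∣⇒≡ᶻ N∣x-y) (∣⇒≡ᶻ N∣u-v) =
    ∣-difference (∣m∣n⇒∣m+n N∣x-y N∣u-v) (lemma x y u v)
    where lemma : ∀ x y u v → (x - y) + (u - v) ≡ (x + u) - (y + v)
          lemma = solve-∀

  *-cong-mod : ∀ {x y u v} → x ≡ᶻ y [mod N ] → u ≡ᶻ v [mod N ] → x * u ≡ᶻ y * v [mod N ]
  *-cong-mod {x} {y} {u} {v} (∣⇒≡ᶻ N∣x-y) (∣⇒≡ᶻ N∣u-v) =
    ∣-difference (∣m∣n⇒∣m+n (∣m⇒∣m*n u N∣x-y) (∣n⇒∣m*n y N∣u-v)) (lemma x y u v)
    where lemma : ∀ x y u v → (x - y) * u + y * (u - v) ≡ x * u - y * v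
          lemma = solve-∀

  neg-cong-mod : ∀ {x y} → x ≡ᶻ y [mod N ] → - x ≡ᶻ - y [mod N ]
  neg-cong-mod {x} {y} (∣⇒≡ᶻ N∣x-y) = ∣-difference (∣m⇒∣-m N∣x-y) (lemma x y)
    where lemma : ∀ x y → - (x - y) ≡ - x - - y
          lemma = solve-∀

  ≡ᶻ-mod-∣ : ∀ {d x y} → d ℕ∣ N → x ≡ᶻ y [mod N ] → x ≡ᶻ y [mod d ]
  ≡ᶻ-mod-∣ d∣N (∣⇒≡ᶻ N∣x-y) = ∣⇒≡ᶻ (∣-trans (∣ᵤ⇒∣ d∣N) N∣x-y)

  ≡ᶻ-multiple : ∀ k → + N * k ≡ᶻ 0ℤ [mod N ]
  ≡ᶻ-multiple k = ∣-difference (divides k (ℤ.*-comm (+ N) k)) (≡.sym (ℤ.+-identityʳ (+ N * k)))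

≡ᶻ-mod-1 : ∀ x y → x ≡ᶻ y [mod 1 ]
≡ᶻ-mod-1 x y = ∣⇒≡ᶻ (divides (x - y) (≡.sym (ℤ.*-identityʳ (x - y))))

ℤ/_ : ℕ → CommutativeRing 0ℓ 0ℓ
ℤ/ N = record
  { _≈_ = _≡ᶻ_[mod N ]
  ; _+_ = _+_
  ; _*_ = _*_
  ; -_ = -_
  ; 0# = 0ℤ
  ; 1# = 1ℤ
  ; isCommutativeRing = record
    { isRing = record
      { +-isAbelianGroup = record
        { isGroup = record
          { isMonoid = record
            { isSemigroup = record
              { isMagma = record { isEquivalence = ≡ᶻ-isEquivalence ; ∙-cong = +-cong-mod }
              ; assoc = λ x y z → ≡⇒≡ᶻ (ℤ.+-assoc x y z)
              }
            ; identity = (≡⇒≡ᶻ ∘ ℤ.+-identityˡ) , (≡⇒≡ᶻ ∘ ℤ.+-identityʳ)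
            }
          ; inverse = (≡⇒≡ᶻ ∘ ℤ.+-inverseˡ) , (≡⇒≡ᶻ ∘ ℤ.+-inverseʳ)
          ; ⁻¹-cong = neg-cong-mod
          }
        ; comm = λ x y → ≡⇒≡ᶻ (ℤ.+-comm x y)
        }
      ; *-cong = *-cong-mod
      ; *-assoc = λ x y z → ≡⇒≡ᶻ (ℤ.*-assoc x y z)
      ; *-identity = (≡⇒≡ᶻ ∘ ℤ.*-identityˡ) , (≡⇒≡ᶻ ∘ ℤ.*-identityʳ)
      ; distrib = (λ x y z → ≡⇒≡ᶻ (ℤ.*-distribˡ-+ x y z)) , (λ x y z → ≡⇒≡ᶻ (ℤ.*-distribʳ-+ x y z))
      }
    ; *-comm = λ x y → ≡⇒≡ᶻ (ℤ.*-comm x y)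
    }
  }

∣m⊖n∣≡∣m-n∣ : ∀ m n → ∣ m ⊖ n ∣ ≡ ℕ.∣ m - n ∣
∣m⊖n∣≡∣m-n∣ zero    zero    = refl
∣m⊖n∣≡∣m-n∣ zero    (suc n) = refl
∣m⊖n∣≡∣m-n∣ (suc m) zero    = refl
∣m⊖n∣≡∣m-n∣ (suc m) (suc n) =
  ≡.trans (≡.cong ∣_∣ (ℤ.[1+m]⊖[1+n]≡m⊖n m n)) (∣m⊖n∣≡∣m-n∣ m n)

∣+m-+n∣≡∣m-n∣ : ∀ m n → ∣ + m - + n ∣ ≡ ℕ.∣ m - n ∣
∣+m-+n∣≡∣m-n∣ m n = ≡.trans (≡.cong ∣_∣ (ℤ.m-n≡m⊖n m n)) (∣m⊖n∣≡∣m-n∣ m n)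

module _ {N : ℕ} where

  ≡mod⇒≡ᶻ : ∀ m n → m ≡ n [mod N ] → + m ≡ᶻ + n [mod N ]
  ≡mod⇒≡ᶻ m n N∣∣m-n∣ =
    ∣⇒≡ᶻ (∣ᵤ⇒∣ (≡.subst (N ℕ∣_) (≡.sym (∣+m-+n∣≡∣m-n∣ m n)) N∣∣m-n∣))

  ≡ᶻ⇒≡mod : ∀ m n → + m ≡ᶻ + n [mod N ] → m ≡ n [mod N ]
  ≡ᶻ⇒≡mod m n (∣⇒≡ᶻ N∣m-n) = ≡.subst (N ℕ∣_) (∣+m-+n∣≡∣m-n∣ m n) (∣⇒∣ᵤ N∣m-n)

  pos-+-cong : ∀ {a b c d} → + a ≡ᶻ + b [mod N ] → + c ≡ᶻ + d [mod N ] →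
               + (a ℕ.+ c) ≡ᶻ + (b ℕ.+ d) [mod N ]
  pos-+-cong {a} {b} {c} {d} a≡b c≡d =
    ≡.subst₂ (λ s t → s ≡ᶻ t [mod N ]) (≡.sym (ℤ.pos-+ a c)) (≡.sym (ℤ.pos-+ b d)) (+-cong-mod a≡b c≡d)

  pos-*-cong : ∀ {a b c d} → + a ≡ᶻ + b [mod N ] → + c ≡ᶻ + d [mod N ] →
               + (a ℕ.* c) ≡ᶻ + (b ℕ.* d) [mod N ]
  pos-*-cong {a} {b} {c} {d} a≡b c≡d =
    ≡.subst₂ (λ s t → s ≡ᶻ t [mod N ]) (≡.sym (ℤ.pos-* a c)) (≡.sym (ℤ.pos-* b d)) (*-cong-mod a≡b c≡d)

pos-*³ : ∀ a b c → + (a ℕ.* b ℕ.* c) ≡ + a * + b * + c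
pos-*³ a b c = ≡.trans (ℤ.pos-* (a ℕ.* b) c) (≡.cong (_* + c) (ℤ.pos-* a b))

module Units {c ℓ} (M : CommutativeMonoid c ℓ) where
  open CommutativeMonoid M
  open import Algebra.Properties.Monoid monoid using (cancelʳ)
  open import Algebra.Properties.CommutativeSemigroup commutativeSemigroup using (interchange)
  open import Relation.Binary.Reasoning.Setoid setoid

  record Unit (x : Carrier) : Set (c ⊔ ℓ) where
    constructor mkUnit
    field
      inverse  : Carrier
      inverseʳ : x ∙ inverse ≈ ε

  unit-resp-≈ : ∀ {x y} → x ≈ y → Unit x → Unit y
  unit-resp-≈ x≈y (mkUnit x⁻¹ xx⁻¹≈ε) = mkUnit x⁻¹ (trans (∙-congʳ (sym x≈y)) xx⁻¹≈ε)

  inverse⇒unit : ∀ {x y} → x ∙ y ≈ ε → Unit y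
  inverse⇒unit {x} {y} xy≈ε = mkUnit x (trans (comm y x) xy≈ε)

  ∙-unit : ∀ {x y} → Unit x → Unit y → Unit (x ∙ y)
  ∙-unit {x} {y} (mkUnit x⁻¹ xx⁻¹≈ε) (mkUnit y⁻¹ yy⁻¹≈ε) = mkUnit (x⁻¹ ∙ y⁻¹) (begin
    (x ∙ y) ∙ (x⁻¹ ∙ y⁻¹) ≈⟨ interchange x y x⁻¹ y⁻¹ ⟩
    (x ∙ x⁻¹) ∙ (y ∙ y⁻¹) ≈⟨ ∙-cong xx⁻¹≈ε yy⁻¹≈ε ⟩
    ε ∙ ε                 ≈⟨ identityˡ ε ⟩
    ε                     ∎)

  inverse-unique : ∀ {x x' y y'} → x ≈ x' → x ∙ y ≈ ε → x' ∙ y' ≈ ε → y ≈ y'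
  inverse-unique {x} {x'} {y} {y'} x≈x' xy≈ε x'y'≈ε = begin
    y                ≈⟨ cancelʳ x'y'≈ε y ⟨
    (y ∙ x') ∙ y'    ≈⟨ ∙-congʳ (trans (comm y x') (∙-congʳ (sym x≈x'))) ⟩
    (x ∙ y) ∙ y'     ≈⟨ ∙-congʳ xy≈ε ⟩
    ε ∙ y'           ≈⟨ identityˡ y' ⟩
    y'               ∎

  unit-cancelʳ : ∀ {g x y} → Unit g → x ∙ g ≈ y ∙ g → x ≈ y
  unit-cancelʳ {g} {x} {y} (mkUnit g⁻¹ gg⁻¹≈ε) xg≈yg = begin
    x                ≈⟨ cancelʳ gg⁻¹≈ε x ⟨
    (x ∙ g) ∙ g⁻¹    ≈⟨ ∙-congʳ xg≈yg ⟩
    (y ∙ g) ∙ g⁻¹    ≈⟨ cancelʳ gg⁻¹≈ε y ⟩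
    y                ∎

module UnitsMod {N : ℕ} = Units (CommutativeRing.*-commutativeMonoid (ℤ/ N))
open UnitsMod using (mkUnit; unit-resp-≈; inverse⇒unit; ∙-unit; inverse-unique; unit-cancelʳ)

UnitMod : ℕ → ℤ → Set
UnitMod N = UnitsMod.Unit {N}

unitMod-1 : ∀ x → UnitMod 1 x
unitMod-1 x = mkUnit 0ℤ (≡ᶻ-mod-1 _ _)

unitMod-∣ : ∀ {d N x} → d ℕ∣ N → UnitMod N x → UnitMod d x
unitMod-∣ d∣N (mkUnit y xy≡1) = mkUnit y (≡ᶻ-mod-∣ d∣N xy≡1)

-- (x y - 1) (x y' - 1) ≡ 0 modulo m n, and expanding gives an inverse of x modulo m n.
unitMod-* : ∀ {m n x} → UnitMod m x → UnitMod n x → UnitMod (m ℕ.* n) x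
unitMod-* {m} {n} {x} (mkUnit y (∣⇒≡ᶻ m∣xy-1)) (mkUnit y' (∣⇒≡ᶻ n∣xy'-1)) =
  mkUnit (y + y' - x * y * y') (∣-difference (∣m⇒∣-m mn∣product) (lemma x y y'))
  where
  mn∣product : + (m ℕ.* n) ∣ (x * y - 1ℤ) * (x * y' - 1ℤ)
  mn∣product = ≡.subst (_∣ (x * y - 1ℤ) * (x * y' - 1ℤ)) (≡.sym (ℤ.pos-* m n))
    (∣-trans (*-monoˡ-∣ (+ n) m∣xy-1) (*-monoʳ-∣ (x * y - 1ℤ) n∣xy'-1))
  lemma : ∀ x y y' → - ((x * y - 1ℤ) * (x * y' - 1ℤ)) ≡ x * (y + y' - x * y * y') - 1ℤ
  lemma = solve-∀

unitMod-^ : ∀ {p x} → UnitMod p x → ∀ n → UnitMod (p ^ n) x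
unitMod-^ {x = x} unit zero    = unitMod-1 x
unitMod-^         unit (suc n) = unitMod-* unit (unitMod-^ unit n)

invMod-inverse : ∀ m N .{{_ : ℕ.NonZero N}} → Coprime m N → + m * + invMod m N ≡ᶻ 1ℤ [mod N ]
invMod-inverse m (suc n) coprime with Bézout.lemma m (suc n)
... | Bézout.result d gcd identity with coprime (GCD.commonDivisor gcd)
invMod-inverse m (suc n) _ | Bézout.result _ _ (Bézout.+- x y eq) | refl =
  ∣-difference (divides (+ y) mx-1≡y[1+n]) refl
  where
  mx-1≡y[1+n] : + m * + x - 1ℤ ≡ + y * (1ℤ + + n)
  mx-1≡y[1+n] = begin
    + m * + x - 1ℤ                ≡⟨ ≡.cong (_- 1ℤ) (≡.trans (ℤ.*-comm (+ m) (+ x)) (≡.sym (ℤ.pos-* x m))) ⟩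
    + (x ℕ.* m) - 1ℤ              ≡⟨ ≡.cong (λ t → + t - 1ℤ) eq ⟨
    + (1 ℕ.+ y ℕ.* suc n) - 1ℤ    ≡⟨ ≡.cong (λ t → 1ℤ + t - 1ℤ) (ℤ.pos-* y (suc n)) ⟩
    1ℤ + + y * (1ℤ + + n) - 1ℤ    ≡⟨ lemma (+ y) (+ n) ⟩
    + y * (1ℤ + + n)              ∎
    where
    open ≡.≡-Reasoning
    lemma : ∀ y n → 1ℤ + y * (1ℤ + n) - 1ℤ ≡ y * (1ℤ + n)
    lemma = solve-∀
invMod-inverse m (suc n) _ | Bézout.result _ _ (Bézout.-+ x y eq) | refl =
  ∣-difference (divides (+ x * + m - + y) m[xn]-1≡[xm-y][1+n]) refl
  where
  m[xn]-1≡[xm-y][1+n] : + m * + (x ℕ.* n) - 1ℤ ≡ (+ x * + m - + y) * (1ℤ + + n)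
  m[xn]-1≡[xm-y][1+n] = begin
    + m * + (x ℕ.* n) - 1ℤ                         ≡⟨ ≡.cong (λ t → + m * t - 1ℤ) (ℤ.pos-* x n) ⟩
    + m * (+ x * + n) - 1ℤ                         ≡⟨ lemma₁ (+ m) (+ x) (+ n) ⟩
    + x * + m * (1ℤ + + n) - (1ℤ + + x * + m)     ≡⟨ ≡.cong (λ t → + x * + m * (1ℤ + + n) - t) 1+xm≡y[1+n] ⟩
    + x * + m * (1ℤ + + n) - + y * (1ℤ + + n)     ≡⟨ lemma₂ (+ x * + m) (+ y) (+ n) ⟩
    (+ x * + m - + y) * (1ℤ + + n)                ∎
    where
    open ≡.≡-Reasoning
    1+xm≡y[1+n] : 1ℤ + + x * + m ≡ + y * (1ℤ + + n)
    1+xm≡y[1+n] = ≡.trans (≡.cong (λ t → 1ℤ + t) (≡.sym (ℤ.pos-* x m)))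
                    (≡.trans (≡.cong +_ eq) (ℤ.pos-* y (suc n)))
    lemma₁ : ∀ m x n → m * (x * n) - 1ℤ ≡ x * m * (1ℤ + n) - (1ℤ + x * m)
    lemma₁ = solve-∀
    lemma₂ : ∀ a y n → a * (1ℤ + n) - y * (1ℤ + n) ≡ (a - y) * (1ℤ + n)
    lemma₂ = solve-∀

coprime⇒unitMod : ∀ {m N} .{{_ : ℕ.NonZero N}} → Coprime m N → UnitMod N (+ m)
coprime⇒unitMod {m} {N} coprime = mkUnit (+ invMod m N) (invMod-inverse m N coprime)

unitMod⇒coprime : ∀ {m N} → UnitMod N (+ m) → Coprime m N
unitMod⇒coprime {m} {N} (mkUnit y (∣⇒≡ᶻ N∣my-1)) {i} (i∣m , i∣N) = ℕ.∣1⇒≡1 (∣⇒∣ᵤ i∣1)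
  where
  i∣1 : + i ∣ 1ℤ
  i∣1 = ≡.subst (+ i ∣_) (lemma (+ m * y))
          (∣m∣n⇒∣m-n (∣m⇒∣m*n y (∣ᵤ⇒∣ {+ i} {+ m} i∣m)) (∣-trans (∣ᵤ⇒∣ {+ i} {+ N} i∣N) N∣my-1))
    where lemma : ∀ a → a - (a - 1ℤ) ≡ 1ℤ
          lemma = solve-∀

unitMod? : ∀ N .{{_ : ℕ.NonZero N}} m → Dec (UnitMod N (+ m))
unitMod? N m = map′ coprime⇒unitMod unitMod⇒coprime (coprime? m N)

module _ {N : ℕ} where
  open CommutativeRing (ℤ/ N) using (setoid; *-congˡ; *-congʳ; +-congˡ; +-congʳ)
  open import Relation.Binary.Reasoning.Setoid setoid

  cross-multiply : ∀ {n d d' m e e'} → d * d' ≡ᶻ 1ℤ [mod N ] → e * e' ≡ᶻ 1ℤ [mod N ] →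
                   n * d' ≡ᶻ m * e' [mod N ] → n * e ≡ᶻ m * d [mod N ]
  cross-multiply {n} {d} {d'} {m} {e} {e'} dd'≡1 ee'≡1 nd'≡me' = begin
    n * e               ≡⟨ solve (n ∷ e ∷ []) ⟩
    n * 1ℤ * e          ≈⟨ *-congʳ {e} (*-congˡ {n} dd'≡1) ⟨
    n * (d * d') * e    ≡⟨ solve (n ∷ d ∷ d' ∷ e ∷ []) ⟩
    n * d' * (d * e)    ≈⟨ *-congʳ {d * e} nd'≡me' ⟩
    m * e' * (d * e)    ≡⟨ solve (m ∷ e' ∷ d ∷ e ∷ []) ⟩
    m * d * (e * e')    ≈⟨ *-congˡ {m * d} ee'≡1 ⟩
    m * d * 1ℤ          ≡⟨ ℤ.*-identityʳ (m * d) ⟩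
    m * d               ∎

  -- x' + a x is the fraction (1 + a x²) / x.
  map₁-injective-mod : ∀ {a x x' y y'} → x * x' ≡ᶻ 1ℤ [mod N ] → y * y' ≡ᶻ 1ℤ [mod N ] →
                       UnitMod N (1ℤ - a * (x * y)) → x' + a * x ≡ᶻ y' + a * y [mod N ] → x ≡ᶻ y [mod N ]
  map₁-injective-mod {a} {x} {x'} {y} {y'} xx'≡1 yy'≡1 g-unit x'+ax≡y'+ay = unit-cancelʳ g-unit (begin
    x * (1ℤ - a * (x * y))                        ≡⟨ solve (a ∷ x ∷ y ∷ []) ⟩
    (1ℤ + a * y * y) * x - a * x * y * (x + y)    ≈⟨ +-congʳ { - (a * x * y * (x + y))} cross ⟨
    (1ℤ + a * x * x) * y - a * x * y * (x + y)    ≡⟨ solve (a ∷ x ∷ y ∷ []) ⟩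
    y * (1ℤ - a * (x * y))                        ∎)
    where
    as-fraction : ∀ {z z'} → z * z' ≡ᶻ 1ℤ [mod N ] → z' + a * z ≡ᶻ (1ℤ + a * z * z) * z' [mod N ]
    as-fraction {z} {z'} zz'≡1 = begin
      z' + a * z                ≡⟨ solve (z' ∷ a ∷ z ∷ []) ⟩
      z' + a * z * 1ℤ           ≈⟨ +-congˡ {z'} (*-congˡ {a * z} zz'≡1) ⟨
      z' + a * z * (z * z')     ≡⟨ solve (z' ∷ a ∷ z ∷ []) ⟩
      (1ℤ + a * z * z) * z'     ∎
    cross : (1ℤ + a * x * x) * y ≡ᶻ (1ℤ + a * y * y) * x [mod N ]
    cross = cross-multiply {1ℤ + a * x * x} {x} {x'} {1ℤ + a * y * y} {y} {y'} xx'≡1 yy'≡1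
      (≡ᶻ-trans (≡ᶻ-sym (as-fraction xx'≡1)) (≡ᶻ-trans x'+ax≡y'+ay (as-fraction yy'≡1)))

  map₂-injective-mod : ∀ {a u x d' y e'} → (a * x + u) * d' ≡ᶻ 1ℤ [mod N ] → (a * y + u) * e' ≡ᶻ 1ℤ [mod N ] →
                       UnitMod N (a * (a * x * y + u * (x + y)) + + 2 * u * u) →
                       (a * (x * x) + + 2 * u * x) * d' ≡ᶻ (a * (y * y) + + 2 * u * y) * e' [mod N ] →
                       x ≡ᶻ y [mod N ]
  map₂-injective-mod {a} {u} {x} {d'} {y} {e'} dd'≡1 ee'≡1 h-unit fx≡fy = unit-cancelʳ h-unit (begin
    x * (a * (a * x * y + u * (x + y)) + + 2 * u * u)              ≡⟨ solve (a ∷ u ∷ x ∷ y ∷ []) ⟩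
    (a * (x * x) + + 2 * u * x) * (a * y + u) - a * u * x * y      ≈⟨ +-congʳ { - (a * u * x * y)} cross ⟩
    (a * (y * y) + + 2 * u * y) * (a * x + u) - a * u * x * y      ≡⟨ solve (a ∷ u ∷ x ∷ y ∷ []) ⟩
    y * (a * (a * x * y + u * (x + y)) + + 2 * u * u)              ∎)
    where
    cross : (a * (x * x) + + 2 * u * x) * (a * y + u) ≡ᶻ (a * (y * y) + + 2 * u * y) * (a * x + u) [mod N ]
    cross = cross-multiply {a * (x * x) + + 2 * u * x} {a * x + u} {d'} {a * (y * y) + + 2 * u * y} {a * y + u} {e'}
              dd'≡1 ee'≡1 fx≡fy

injective⇒strictlySurjective : ∀ {n} (f : Fin n → Fin n) → Injective _≡_ _≡_ f → StrictlySurjective _≡_ f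
injective⇒strictlySurjective {suc n} f f-injective y with Fin.any? (λ x → f x Fin.≟ y)
... | yes hit = hit
... | no miss =
  let a , b , a<b , collision = Fin.pigeonhole (ℕ.n<1+n n) (λ x → Fin.punchOut (y≢f x))
  in ⊥-elim (Fin.<-irrefl (f-injective (Fin.punchOut-injective (y≢f a) (y≢f b) collision)) a<b)
  where
  y≢f : ∀ x → y ≢ f x
  y≢f x y≡fx = miss (x , ≡.sym y≡fx)

%-≡ᶻ : ∀ m N .{{_ : ℕ.NonZero N}} → + (m % N) ≡ᶻ + m [mod N ]
%-≡ᶻ m N = ≡mod⇒≡ᶻ (m % N) m (ℕ.divides (m / N) (begin
  ℕ.∣ m % N - m ∣                 ≡⟨ ℕ.m≤n⇒∣m-n∣≡n∸m (m%n≤m m N) ⟩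
  m ∸ m % N                       ≡⟨ ≡.cong (_∸ m % N) (m≡m%n+[m/n]*n m N) ⟩
  m % N ℕ.+ m / N ℕ.* N ∸ m % N   ≡⟨ ℕ.m+n∸m≡n (m % N) (m / N ℕ.* N) ⟩
  m / N ℕ.* N                     ∎))
  where open ≡.≡-Reasoning

<-≡ᶻ⇒≡ : ∀ {N a b} → a < N → b < N → + a ≡ᶻ + b [mod N ] → a ≡ b
<-≡ᶻ⇒≡ {N} {a} {b} a<N b<N a≡b with ℕ.∣ a - b ∣ in ∣a-b∣≡ | ≡ᶻ⇒≡mod a b a≡b
... | zero  | _     = ℕ.∣m-n∣≡0⇒m≡n ∣a-b∣≡
... | suc k | N∣1+k = ⊥-elim (ℕ.<⇒≱ 1+k<N (ℕ.∣⇒≤ N∣1+k))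
  where
  1+k<N : suc k < N
  1+k<N = ℕ.≤-<-trans (≡.subst (_≤ a ℕ.⊔ b) ∣a-b∣≡ (ℕ.∣m-n∣≤m⊔n a b)) (ℕ.⊔-lub a<N b<N)

-- G, extended by the identity off U, is an injection of the residues modulo N.
injectiveOn⇒surjectiveOn-mod :
  ∀ N .{{_ : ℕ.NonZero N}} {U : ℕ → Set} → (∀ m → Dec (U m)) →
  (∀ {m m'} → + m ≡ᶻ + m' [mod N ] → U m → U m') →
  (G : ℕ → ℕ) → (∀ {m} → U m → U (G m)) →
  (∀ {m m'} → U m → U m' → + G m ≡ᶻ + G m' [mod N ] → + m ≡ᶻ + m' [mod N ]) →
  ∀ {v} → U v → ∃ λ m → U m × + G m ≡ᶻ + v [mod N ]
injectiveOn⇒surjectiveOn-mod N {U} U? U-resp G G-U G-injective {v} Uv =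
  let k , Hk≡v = injective⇒strictlySurjective H H-injective (residue v)
  in preimage k (U? (toℕ k)) Hk≡v
  where
  residue : ℕ → Fin N
  residue m = m mod N

  residue≡⇒≡ᶻ : ∀ {m k} → residue m ≡ k → + toℕ k ≡ᶻ + m [mod N ]
  residue≡⇒≡ᶻ {m} refl =
    ≡.subst (λ r → + r ≡ᶻ + m [mod N ]) (≡.sym (Fin.toℕ-fromℕ< (m%n<n m N))) (%-≡ᶻ m N)

  same-residue : ∀ {m m'} → residue m ≡ residue m' → + m ≡ᶻ + m' [mod N ]
  same-residue eq = ≡ᶻ-trans (≡ᶻ-sym (residue≡⇒≡ᶻ eq)) (residue≡⇒≡ᶻ refl)

  H′ : ∀ k → Dec (U (toℕ k)) → Fin N
  H′ k (yes _) = residue (G (toℕ k))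
  H′ k (no _)  = k

  H : Fin N → Fin N
  H k = H′ k (U? (toℕ k))

  H′-injective : ∀ {k k'} (Uk? : Dec (U (toℕ k))) (Uk'? : Dec (U (toℕ k'))) → H′ k Uk? ≡ H′ k' Uk'? → k ≡ k'
  H′-injective {k} {k'} (yes Uk) (yes Uk') eq =
    Fin.toℕ-injective (<-≡ᶻ⇒≡ (Fin.toℕ<n k) (Fin.toℕ<n k') (G-injective Uk Uk' (same-residue eq)))
  H′-injective (yes Uk) (no ¬Uk') eq = ⊥-elim (¬Uk' (U-resp (≡ᶻ-sym (residue≡⇒≡ᶻ eq)) (G-U Uk)))
  H′-injective (no ¬Uk) (yes Uk') eq = ⊥-elim (¬Uk (U-resp (≡ᶻ-sym (residue≡⇒≡ᶻ (≡.sym eq))) (G-U Uk')))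
  H′-injective (no _)   (no _)    eq = eq

  H-injective : Injective _≡_ _≡_ H
  H-injective {k} {k'} = H′-injective (U? (toℕ k)) (U? (toℕ k'))

  preimage : ∀ k (Uk? : Dec (U (toℕ k))) → H′ k Uk? ≡ residue v → ∃ λ m → U m × + G m ≡ᶻ + v [mod N ]
  preimage k (yes Uk) eq = toℕ k , Uk , same-residue eq
  preimage k (no ¬Uk) eq = ⊥-elim (¬Uk (U-resp (≡ᶻ-sym (residue≡⇒≡ᶻ (≡.sym eq))) Uv))

^-monoʳ-∣ : ∀ p {m n} → m ≤ n → p ^ m ℕ∣ p ^ n
^-monoʳ-∣ p {m} m≤n with o , refl ← ℕ.m≤n⇒∃[o]m+o≡n m≤n =
  ℕ.divides (p ^ o) (≡.trans (ℕ.^-distribˡ-+-* p m o) (ℕ.*-comm (p ^ m) (p ^ o)))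

≡1-mod⇒1+* : ∀ {P} → 1 < P → ∀ w → + w ≡ᶻ 1ℤ [mod P ] → ∃ λ z → w ≡ 1 ℕ.+ P ℕ.* z
≡1-mod⇒1+* 1<P zero    (∣⇒≡ᶻ P∣-1) = ⊥-elim (ℕ.<⇒≢ 1<P (≡.sym (ℕ.∣1⇒≡1 (∣⇒∣ᵤ P∣-1))))
≡1-mod⇒1+* {P} _ (suc w) w+1≡1 = ℕ.quotient P∣w , ≡.cong suc (ℕ.m∣n⇒n≡m*quotient P∣w)
  where
  P∣w : P ℕ∣ w
  P∣w = ≡.subst (P ℕ∣_) (ℕ.∣-∣-identityʳ w) (≡ᶻ⇒≡mod (suc w) 1 w+1≡1)

levelwise : (ℕ → ℕ → ℕ) → Seq → Seq
levelwise F μ n = F n (μ n)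

module _ {p : ℕ} (1<p : 1 < p) where

  private
    p≢0 : ℕ.NonZero p
    p≢0 = ℕ.>-nonZero (ℕ.<-trans ℕ.z<s 1<p)

    p^n≢0 : ∀ n → ℕ.NonZero (p ^ n)
    p^n≢0 n = ℕ.m^n≢0 p n {{p≢0}}

  p∣p^n : ∀ {n} → 1 ≤ n → p ℕ∣ p ^ n
  p∣p^n {suc n} _ = ℕ.divides (p ^ n) (ℕ.*-comm p (p ^ n))

  IsZp⇒≡ᶻ : ∀ x → IsZp p x → ∀ n → + x (suc n) ≡ᶻ + x n [mod p ^ n ]
  IsZp⇒≡ᶻ x zx n = ≡mod⇒≡ᶻ (x (suc n)) (x n) (zx n)

  ≡ᶻ⇒IsZp : ∀ x → (∀ n → + x (suc n) ≡ᶻ + x n [mod p ^ n ]) → IsZp p x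
  ≡ᶻ⇒IsZp x x≡ n = ≡ᶻ⇒≡mod (x (suc n)) (x n) (x≡ n)

  IsZp-const : ∀ k → IsZp p (const k)
  IsZp-const k = ≡ᶻ⇒IsZp (const k) (λ _ → ≡ᶻ-refl)

  IsZp-+ : ∀ x y → IsZp p x → IsZp p y → IsZp p (x +ₚ y)
  IsZp-+ x y zx zy = ≡ᶻ⇒IsZp (x +ₚ y) (λ n → pos-+-cong (IsZp⇒≡ᶻ x zx n) (IsZp⇒≡ᶻ y zy n))

  IsZp-* : ∀ x y → IsZp p x → IsZp p y → IsZp p (x *ₚ y)
  IsZp-* x y zx zy = ≡ᶻ⇒IsZp (x *ₚ y) (λ n → pos-*-cong (IsZp⇒≡ᶻ x zx n) (IsZp⇒≡ᶻ y zy n))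

  IsZp-≤ : ∀ x → IsZp p x → ∀ {m n} → m ≤ n → + x n ≡ᶻ + x m [mod p ^ m ]
  IsZp-≤ x zx m≤n = go (ℕ.≤⇒≤′ m≤n)
    where
    go : ∀ {m n} → m ℕ.≤′ n → + x n ≡ᶻ + x m [mod p ^ m ]
    go ℕ.≤′-refl            = ≡ᶻ-refl
    go (ℕ.≤′-step {n} m≤′n) =
      ≡ᶻ-trans (≡ᶻ-mod-∣ (^-monoʳ-∣ p (ℕ.≤′⇒≤ m≤′n)) (IsZp⇒≡ᶻ x zx n)) (go m≤′n)

  invMod-p^-inverse : ∀ n {m} → UnitMod (p ^ n) (+ m) → + m * + invMod m (p ^ n) ≡ᶻ 1ℤ [mod p ^ n ]
  invMod-p^-inverse n {m} unit = invMod-inverse m (p ^ n) {{p^n≢0 n}} (unitMod⇒coprime unit)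

  invMod-p^-cong : ∀ n {m m'} → UnitMod (p ^ n) (+ m) → + m ≡ᶻ + m' [mod p ^ n ] →
                   + invMod m (p ^ n) ≡ᶻ + invMod m' (p ^ n) [mod p ^ n ]
  invMod-p^-cong n unit m≡m' =
    inverse-unique m≡m' (invMod-p^-inverse n unit) (invMod-p^-inverse n (unit-resp-≈ m≡m' unit))

  unitMod-levels : ∀ x → IsZp p x → UnitMod p (+ x 1) → ∀ n → UnitMod (p ^ n) (+ x n)
  unitMod-levels x zx x₁-unit zero    = unitMod-1 (+ x 0)
  unitMod-levels x zx x₁-unit (suc n) = unitMod-^ (unit-resp-≈ x₁≡xₙ x₁-unit) (suc n)
    where x₁≡xₙ = ≡ᶻ-mod-∣ (p∣p^n ℕ.≤-refl) (≡ᶻ-sym (IsZp-≤ x zx {1} (ℕ.s≤s ℕ.z≤n)))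

  IsZp-inv : ∀ x → IsZp p x → UnitMod p (+ x 1) → IsZp p (inv p x)
  IsZp-inv x zx x₁-unit = ≡ᶻ⇒IsZp (inv p x) λ n →
    inverse-unique (IsZp⇒≡ᶻ x zx n)
      (≡ᶻ-mod-∣ (^-monoʳ-∣ p (ℕ.n≤1+n n)) (invMod-p^-inverse (suc n) (units (suc n))))
      (invMod-p^-inverse n (units n))
    where units = unitMod-levels x zx x₁-unit

  IsZp-div : ∀ y x → IsZp p y → IsZp p x → UnitMod p (+ x 1) → IsZp p (div p y x)
  IsZp-div y x zy zx x₁-unit = IsZp-* y (inv p x) zy (IsZp-inv x zx x₁-unit)

  unitMod⇒IsUnit : ∀ x → IsZp p x → UnitMod p (+ x 1) → IsUnit p x
  unitMod⇒IsUnit x zx x₁-unit = zx , inv p x , IsZp-inv x zx x₁-unit , λ n →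
    ≡ᶻ⇒≡mod (x n ℕ.* inv p x n) 1
      (≡ᶻ-trans (≡⇒≡ᶻ (ℤ.pos-* (x n) (inv p x n))) (invMod-p^-inverse n (unitMod-levels x zx x₁-unit n)))

  IsUnit⇒unitMod : ∀ x → IsUnit p x → ∀ n → UnitMod (p ^ n) (+ x n)
  IsUnit⇒unitMod x (_ , y , _ , xy≡1) n =
    mkUnit (+ y n) (≡ᶻ-trans (≡⇒≡ᶻ (≡.sym (ℤ.pos-* (x n) (y n)))) (≡mod⇒≡ᶻ (x n ℕ.* y n) 1 (xy≡1 n)))

  IsUnit⇒unitMod-p : ∀ x → IsUnit p x → ∀ {n} → 1 ≤ n → UnitMod p (+ x n)
  IsUnit⇒unitMod-p x ux {n} 1≤n = unitMod-∣ (p∣p^n 1≤n) (IsUnit⇒unitMod x ux n)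

  *-div-≡ᶻ : ∀ y x → IsZp p y → IsUnit p x → ∀ {n m} → n ≤ m → + x n * + div p y x m ≡ᶻ + y n [mod p ^ n ]
  *-div-≡ᶻ y x zy ux {n} {m} n≤m = begin
    + x n * + div p y x m                 ≡⟨ ≡.cong (λ t → + x n * t) (ℤ.pos-* (y m) (x⁻¹ m)) ⟩
    + x n * (+ y m * + x⁻¹ m)             ≈⟨ *-congˡ {+ x n} (*-cong (IsZp-≤ y zy n≤m) (IsZp-≤ x⁻¹ zx⁻¹ n≤m)) ⟩
    + x n * (+ y n * + x⁻¹ n)             ≡⟨ x∙yz≈y∙xz (+ x n) (+ y n) (+ x⁻¹ n) ⟩
    + y n * (+ x n * + x⁻¹ n)             ≈⟨ *-congˡ {+ y n} (invMod-p^-inverse n (IsUnit⇒unitMod x ux n)) ⟩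
    + y n * 1ℤ                            ≡⟨ ℤ.*-identityʳ (+ y n) ⟩
    + y n                                 ∎
    where
    x⁻¹ = inv p x
    zx⁻¹ = IsZp-inv x (proj₁ ux) (IsUnit⇒unitMod-p x ux ℕ.≤-refl)
    open CommutativeRing (ℤ/ (p ^ n)) using (setoid; *-cong; *-congˡ)
    open import Relation.Binary.Reasoning.Setoid setoid

  IsZp-scale : ∀ {i} q z → IsZp p q → (∀ n → q (n ℕ.+ i) ≡ 1 ℕ.+ p ^ i ℕ.* z n) → IsZp p z
  IsZp-scale {i} q z zq q≡1+pⁱz n =
    ℕ.*-cancelˡ-∣ (p ^ i) {{p^n≢0 i}} (≡.subst₂ _ℕ∣_ pⁿ⁺ⁱ≡pⁱpⁿ ∣Δq∣≡pⁱ∣Δz∣ (zq (n ℕ.+ i)))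
    where
    pⁿ⁺ⁱ≡pⁱpⁿ : p ^ (n ℕ.+ i) ≡ p ^ i ℕ.* p ^ n
    pⁿ⁺ⁱ≡pⁱpⁿ = ≡.trans (ℕ.^-distribˡ-+-* p n i) (ℕ.*-comm (p ^ n) (p ^ i))
    ∣Δq∣≡pⁱ∣Δz∣ : ℕ.∣ q (suc n ℕ.+ i) - q (n ℕ.+ i) ∣ ≡ p ^ i ℕ.* ℕ.∣ z (suc n) - z n ∣
    ∣Δq∣≡pⁱ∣Δz∣ = begin
      ℕ.∣ q (suc n ℕ.+ i) - q (n ℕ.+ i) ∣
        ≡⟨ ≡.cong₂ ℕ.∣_-_∣ (q≡1+pⁱz (suc n)) (q≡1+pⁱz n) ⟩
      ℕ.∣ 1 ℕ.+ p ^ i ℕ.* z (suc n) - 1 ℕ.+ p ^ i ℕ.* z n ∣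
        ≡⟨ ℕ.∣m+n-m+o∣≡∣n-o∣ 1 (p ^ i ℕ.* z (suc n)) (p ^ i ℕ.* z n) ⟩
      ℕ.∣ p ^ i ℕ.* z (suc n) - p ^ i ℕ.* z n ∣
        ≡⟨ ℕ.*-distribˡ-∣-∣ (p ^ i) (z (suc n)) (z n) ⟨
      p ^ i ℕ.* ℕ.∣ z (suc n) - z n ∣
        ∎
      where open ≡.≡-Reasoning

  sameCoset⇒≡ᶻ : ∀ {i} μ ν → SameCoset p i μ ν → + μ i ≡ᶻ + ν i [mod p ^ i ]
  sameCoset⇒≡ᶻ {i} μ ν (z , _ , μ≡ν[1+pⁱz]) = begin
    + μ i
      ≈⟨ ≡mod⇒≡ᶻ (μ i) (ν i ℕ.* (1 ℕ.+ p ^ i ℕ.* z i)) (μ≡ν[1+pⁱz] i) ⟩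
    + (ν i ℕ.* (1 ℕ.+ p ^ i ℕ.* z i))
      ≡⟨ ≡.trans (ℤ.pos-* (ν i) _) (≡.cong (λ t → + ν i * (1ℤ + t)) (ℤ.pos-* (p ^ i) (z i))) ⟩
    + ν i * (1ℤ + + (p ^ i) * + z i)
      ≈⟨ *-congˡ {+ ν i} (+-congˡ {1ℤ} (≡ᶻ-multiple (+ z i))) ⟩
    + ν i * (1ℤ + 0ℤ)
      ≡⟨ ℤ.*-identityʳ (+ ν i) ⟩
    + ν i
      ∎
    where
    open CommutativeRing (ℤ/ (p ^ i)) using (setoid; *-congˡ; +-congˡ)
    open import Relation.Binary.Reasoning.Setoid setoid

  -- The scale z is read off q := μ / ν, which is ≡ 1 modulo pⁱ: q (n + i) = 1 + pⁱ z n.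
  ≡ᶻ⇒sameCoset : ∀ {i} → 1 ≤ i → ∀ μ ν → IsZp p μ → IsUnit p ν →
                 + μ i ≡ᶻ + ν i [mod p ^ i ] → SameCoset p i μ ν
  ≡ᶻ⇒sameCoset {i} 1≤i μ ν zμ uν μᵢ≡νᵢ = z , IsZp-scale q z zq q≡1+pⁱz , μ≡ν[1+pⁱz]
    where
    q = div p μ ν
    zq = IsZp-div μ ν zμ (proj₁ uν) (IsUnit⇒unitMod-p ν uν ℕ.≤-refl)

    qᵢ≡1 : + q i ≡ᶻ 1ℤ [mod p ^ i ]
    qᵢ≡1 = unit-cancelʳ {g = + ν i} (IsUnit⇒unitMod ν uν i) (begin
      + q i * + ν i       ≡⟨ ℤ.*-comm (+ q i) (+ ν i) ⟩
      + ν i * + q i       ≈⟨ *-div-≡ᶻ μ ν zμ uν ℕ.≤-refl ⟩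
      + μ i               ≈⟨ μᵢ≡νᵢ ⟩
      + ν i               ≡⟨ ℤ.*-identityˡ (+ ν i) ⟨
      1ℤ * + ν i          ∎)
      where
      open CommutativeRing (ℤ/ (p ^ i)) using (setoid)
      open import Relation.Binary.Reasoning.Setoid setoid

    decomposition : ∀ n → ∃ λ z → q (n ℕ.+ i) ≡ 1 ℕ.+ p ^ i ℕ.* z
    decomposition n = ≡1-mod⇒1+* (ℕ.^-monoʳ-< p 1<p 1≤i) (q (n ℕ.+ i))
                        (≡ᶻ-trans (IsZp-≤ q zq (ℕ.m≤n+m i n)) qᵢ≡1)

    z : Seq
    z n = proj₁ (decomposition n)

    q≡1+pⁱz : ∀ n → q (n ℕ.+ i) ≡ 1 ℕ.+ p ^ i ℕ.* z n
    q≡1+pⁱz n = proj₂ (decomposition n)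

    μ≡ν[1+pⁱz] : ∀ n → μ n ≡ ν n ℕ.* (1 ℕ.+ p ^ i ℕ.* z n) [mod p ^ n ]
    μ≡ν[1+pⁱz] n = ≡ᶻ⇒≡mod (μ n) (ν n ℕ.* (1 ℕ.+ p ^ i ℕ.* z n))
      (≡ᶻ-sym (≡ᶻ-trans (≡⇒≡ᶻ ν[1+pⁱz]≡νq) (*-div-≡ᶻ μ ν zμ uν (ℕ.m≤m+n n i))))
      where
      ν[1+pⁱz]≡νq : + (ν n ℕ.* (1 ℕ.+ p ^ i ℕ.* z n)) ≡ + ν n * + q (n ℕ.+ i)
      ν[1+pⁱz]≡νq = ≡.trans (≡.cong (λ t → + (ν n ℕ.* t)) (≡.sym (q≡1+pⁱz n))) (ℤ.pos-* (ν n) _)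

  levelwise-descends :
    ∀ {i} → 1 ≤ i → (F : ℕ → ℕ → ℕ) →
    (∀ μ → IsUnit p μ → IsZp p (levelwise F μ)) →
    (∀ {n m} → 1 ≤ n → UnitMod p (+ m) → UnitMod p (+ F n m)) →
    (∀ {m m'} → UnitMod p (+ m) → + m ≡ᶻ + m' [mod p ^ i ] → + F i m ≡ᶻ + F i m' [mod p ^ i ]) →
    (∀ {m m'} → UnitMod p (+ m) → UnitMod p (+ m') →
       + F i m ≡ᶻ + F i m' [mod p ^ i ] → + m ≡ᶻ + m' [mod p ^ i ]) →
    DescendsToBijection p i (levelwise F)
  levelwise-descends {i} 1≤i F F-IsZp F-unit F-cong F-injective = F-IsUnit , well-defined , injective , surjective
    where
    F-IsUnit : ∀ μ → IsUnit p μ → IsUnit p (levelwise F μ)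
    F-IsUnit μ uμ =
      unitMod⇒IsUnit (levelwise F μ) (F-IsZp μ uμ) (F-unit ℕ.≤-refl (IsUnit⇒unitMod-p μ uμ ℕ.≤-refl))

    well-defined : ∀ μ ν → IsUnit p μ → IsUnit p ν → SameCoset p i μ ν →
                   SameCoset p i (levelwise F μ) (levelwise F ν)
    well-defined μ ν uμ uν μ~ν =
      ≡ᶻ⇒sameCoset 1≤i (levelwise F μ) (levelwise F ν) (proj₁ (F-IsUnit μ uμ)) (F-IsUnit ν uν)
        (F-cong (IsUnit⇒unitMod-p μ uμ 1≤i) (sameCoset⇒≡ᶻ μ ν μ~ν))

    injective : ∀ μ ν → IsUnit p μ → IsUnit p ν → SameCoset p i (levelwise F μ) (levelwise F ν) →
                SameCoset p i μ ν
    injective μ ν uμ uν Fμ~Fν = ≡ᶻ⇒sameCoset 1≤i μ ν (proj₁ uμ) uν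
      (F-injective (IsUnit⇒unitMod-p μ uμ 1≤i) (IsUnit⇒unitMod-p ν uν 1≤i)
                   (sameCoset⇒≡ᶻ (levelwise F μ) (levelwise F ν) Fμ~Fν))

    surjective : ∀ ν → IsUnit p ν → ∃ λ μ → IsUnit p μ × SameCoset p i (levelwise F μ) ν
    surjective ν uν =
      let m , m-unit , Fm≡νᵢ = injectiveOn⇒surjectiveOn-mod (p ^ i) {{p^n≢0 i}} (unitMod? p {{p≢0}})
                                 (unit-resp-≈ ∘ ≡ᶻ-mod-∣ (p∣p^n 1≤i)) (F i) (F-unit 1≤i) F-injective
                                 (IsUnit⇒unitMod-p ν uν 1≤i)
          const-m-unit = unitMod⇒IsUnit (const m) (IsZp-const m) m-unit
      in const m , const-m-unit ,
         ≡ᶻ⇒sameCoset 1≤i (levelwise F (const m)) ν (proj₁ (F-IsUnit (const m) const-m-unit)) uν Fm≡νᵢ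

  InPZp⇒≡ᶻ0 : ∀ a → InPZp p a → ∀ {n} → 1 ≤ n → + a n ≡ᶻ 0ℤ [mod p ]
  InPZp⇒≡ᶻ0 a (_ , c , _ , a≡pc) {n} 1≤n =
    ≡ᶻ-trans (≡ᶻ-mod-∣ (p∣p^n 1≤n) (≡mod⇒≡ᶻ (a n) (p ℕ.* c n) (a≡pc n)))
      (≡ᶻ-trans (≡⇒≡ᶻ (ℤ.pos-* p (c n))) (≡ᶻ-multiple (+ c n)))

  -- map₁ p a and map₂ p a u are definitionally levelwise map₁-level and levelwise map₂-level.
  module _ (a : Seq) (a∈pℤₚ : InPZp p a) where

    a*t≡0 : ∀ {n} → 1 ≤ n → ∀ t → + a n * t ≡ᶻ 0ℤ [mod p ]
    a*t≡0 1≤n t = *-cong-mod (InPZp⇒≡ᶻ0 a a∈pℤₚ 1≤n) (≡ᶻ-refl {x = t})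

    a*t+s≡s : ∀ {n} → 1 ≤ n → ∀ t s → + a n * t + s ≡ᶻ s [mod p ]
    a*t+s≡s 1≤n t s = ≡ᶻ-trans (+-cong-mod (a*t≡0 1≤n t) (≡ᶻ-refl {x = s})) (≡⇒≡ᶻ (ℤ.+-identityˡ s))

    map₁-level : ℕ → ℕ → ℕ
    map₁-level n m = invMod m (p ^ n) ℕ.+ a n ℕ.* m

    map₁-level-ℤ : ∀ n m → + map₁-level n m ≡ + invMod m (p ^ n) + + a n * + m
    map₁-level-ℤ n m =
      ≡.trans (ℤ.pos-+ (invMod m (p ^ n)) (a n ℕ.* m)) (≡.cong (λ t → + invMod m (p ^ n) + t) (ℤ.pos-* (a n) m))

    map₁-IsZp : ∀ μ → IsUnit p μ → IsZp p (map₁ p a μ)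
    map₁-IsZp μ uμ = IsZp-+ (inv p μ) (a *ₚ μ) (IsZp-inv μ (proj₁ uμ) (IsUnit⇒unitMod-p μ uμ ℕ.≤-refl))
                       (IsZp-* a μ (proj₁ a∈pℤₚ) (proj₁ uμ))

    map₁-level-unit : ∀ {n m} → 1 ≤ n → UnitMod p (+ m) → UnitMod p (+ map₁-level n m)
    map₁-level-unit {n} {m} 1≤n m-unit = unit-resp-≈ m⁻¹≡map₁ m⁻¹-unit
      where
      m⁻¹-unit : UnitMod p (+ invMod m (p ^ n))
      m⁻¹-unit = unitMod-∣ (p∣p^n 1≤n) (inverse⇒unit {x = + m} (invMod-p^-inverse n (unitMod-^ m-unit n)))
      m⁻¹≡map₁ : + invMod m (p ^ n) ≡ᶻ + map₁-level n m [mod p ]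
      m⁻¹≡map₁ = ≡ᶻ-sym (≡ᶻ-trans (≡⇒≡ᶻ (map₁-level-ℤ n m))
                   (≡ᶻ-trans (+-cong-mod (≡ᶻ-refl {x = + invMod m (p ^ n)}) (a*t≡0 1≤n (+ m)))
                             (≡⇒≡ᶻ (ℤ.+-identityʳ _))))

    map₁-level-cong : ∀ {n m m'} → UnitMod p (+ m) → + m ≡ᶻ + m' [mod p ^ n ] →
                      + map₁-level n m ≡ᶻ + map₁-level n m' [mod p ^ n ]
    map₁-level-cong {n} m-unit m≡m' =
      pos-+-cong (invMod-p^-cong n (unitMod-^ m-unit n) m≡m') (pos-*-cong (≡ᶻ-refl {x = + a n}) m≡m')

    map₁-level-injective : ∀ {n} → 1 ≤ n → ∀ {m m'} → UnitMod p (+ m) → UnitMod p (+ m') →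
                           + map₁-level n m ≡ᶻ + map₁-level n m' [mod p ^ n ] → + m ≡ᶻ + m' [mod p ^ n ]
    map₁-level-injective {n} 1≤n {m} {m'} m-unit m'-unit map₁-eq =
      map₁-injective-mod {a = + a n} {x' = + invMod m (p ^ n)} {y' = + invMod m' (p ^ n)}
        (invMod-p^-inverse n (unitMod-^ m-unit n)) (invMod-p^-inverse n (unitMod-^ m'-unit n)) (unitMod-^ g-unit n)
        (≡.subst₂ (λ s t → s ≡ᶻ t [mod p ^ n ]) (map₁-level-ℤ n m) (map₁-level-ℤ n m') map₁-eq)
      where
      g-unit : UnitMod p (1ℤ - + a n * (+ m * + m'))
      g-unit = unit-resp-≈ (≡ᶻ-sym (+-cong-mod (≡ᶻ-refl {x = 1ℤ}) (neg-cong-mod (a*t≡0 1≤n (+ m * + m')))))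
                 (mkUnit 1ℤ ≡ᶻ-refl)

    map₁-descends : ∀ {i} → 1 ≤ i → DescendsToBijection p i (map₁ p a)
    map₁-descends 1≤i =
      levelwise-descends 1≤i map₁-level map₁-IsZp map₁-level-unit map₁-level-cong (map₁-level-injective 1≤i)

    module _ (u : Seq) (u-unit : IsUnit p u) (2-unit : UnitMod p (+ 2)) where

      numerator : ℕ → ℕ → ℕ
      numerator n m = a n ℕ.* m ℕ.* m ℕ.+ 2 ℕ.* u n ℕ.* m

      denominator : ℕ → ℕ → ℕ
      denominator n m = a n ℕ.* m ℕ.+ u n

      map₂-level : ℕ → ℕ → ℕ
      map₂-level n m = numerator n m ℕ.* invMod (denominator n m) (p ^ n)

      numerator-ℤ : ∀ n m → + numerator n m ≡ + a n * (+ m * + m) + + 2 * + u n * + m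
      numerator-ℤ n m = ≡.trans (ℤ.pos-+ (a n ℕ.* m ℕ.* m) (2 ℕ.* u n ℕ.* m))
        (≡.cong₂ _+_ (≡.trans (pos-*³ (a n) m m) (ℤ.*-assoc (+ a n) (+ m) (+ m))) (pos-*³ 2 (u n) m))

      denominator-ℤ : ∀ n m → + denominator n m ≡ + a n * + m + + u n
      denominator-ℤ n m = ≡.trans (ℤ.pos-+ (a n ℕ.* m) (u n)) (≡.cong (_+ + u n) (ℤ.pos-* (a n) m))

      map₂-level-ℤ : ∀ n m →
        + map₂-level n m ≡ (+ a n * (+ m * + m) + + 2 * + u n * + m) * + invMod (denominator n m) (p ^ n)
      map₂-level-ℤ n m =
        ≡.trans (ℤ.pos-* (numerator n m) _) (≡.cong (_* + invMod (denominator n m) (p ^ n)) (numerator-ℤ n m))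

      uₙ-unit : ∀ {n} → 1 ≤ n → UnitMod p (+ u n)
      uₙ-unit = IsUnit⇒unitMod-p u u-unit

      denominator-unit : ∀ {n m} → 1 ≤ n → UnitMod p (+ denominator n m)
      denominator-unit {n} {m} 1≤n =
        unit-resp-≈ (≡ᶻ-sym (≡ᶻ-trans (≡⇒≡ᶻ (denominator-ℤ n m)) (a*t+s≡s 1≤n (+ m) (+ u n))))
          (uₙ-unit 1≤n)

      denominator-inverse : ∀ {n} → 1 ≤ n → ∀ m →
                            (+ a n * + m + + u n) * + invMod (denominator n m) (p ^ n) ≡ᶻ 1ℤ [mod p ^ n ]
      denominator-inverse {n} 1≤n m = ≡.subst (λ d → d * + invMod (denominator n m) (p ^ n) ≡ᶻ 1ℤ [mod p ^ n ])
        (denominator-ℤ n m) (invMod-p^-inverse n (unitMod-^ (denominator-unit 1≤n) n))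

      map₂-IsZp : ∀ μ → IsUnit p μ → IsZp p (map₂ p a u μ)
      map₂-IsZp μ (zμ , _) = IsZp-div num den zNum zDen (denominator-unit ℕ.≤-refl)
        where
        aμ = a *ₚ μ
        zaμ = IsZp-* a μ (proj₁ a∈pℤₚ) zμ
        num = aμ *ₚ μ +ₚ const 2 *ₚ u *ₚ μ
        den = aμ +ₚ u
        zNum : IsZp p num
        zNum = IsZp-+ (aμ *ₚ μ) (const 2 *ₚ u *ₚ μ) (IsZp-* aμ μ zaμ zμ)
                 (IsZp-* (const 2 *ₚ u) μ (IsZp-* (const 2) u (IsZp-const 2) (proj₁ u-unit)) zμ)
        zDen : IsZp p den
        zDen = IsZp-+ aμ u zaμ (proj₁ u-unit)

      map₂-level-unit : ∀ {n m} → 1 ≤ n → UnitMod p (+ m) → UnitMod p (+ map₂-level n m)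
      map₂-level-unit {n} {m} 1≤n m-unit =
        ≡.subst (UnitMod p) (≡.sym (ℤ.pos-* (numerator n m) _)) (∙-unit numerator-unit denominator⁻¹-unit)
        where
        numerator-unit : UnitMod p (+ numerator n m)
        numerator-unit = unit-resp-≈ (≡ᶻ-sym (≡ᶻ-trans (≡⇒≡ᶻ (numerator-ℤ n m)) (a*t+s≡s 1≤n (+ m * + m) _)))
                           (∙-unit (∙-unit 2-unit (uₙ-unit 1≤n)) m-unit)
        denominator⁻¹-unit : UnitMod p (+ invMod (denominator n m) (p ^ n))
        denominator⁻¹-unit = unitMod-∣ (p∣p^n 1≤n)
          (inverse⇒unit {x = + denominator n m} (invMod-p^-inverse n (unitMod-^ (denominator-unit 1≤n) n)))

      map₂-level-cong : ∀ {n} → 1 ≤ n → ∀ {m m'} → UnitMod p (+ m) → + m ≡ᶻ + m' [mod p ^ n ] →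
                        + map₂-level n m ≡ᶻ + map₂-level n m' [mod p ^ n ]
      map₂-level-cong {n} 1≤n _ m≡m' = pos-*-cong numerator-cong
        (invMod-p^-cong n (unitMod-^ (denominator-unit 1≤n) n) denominator-cong)
        where
        numerator-cong = pos-+-cong (pos-*-cong (pos-*-cong (≡ᶻ-refl {x = + a n}) m≡m') m≡m')
                                    (pos-*-cong (≡ᶻ-refl {x = + (2 ℕ.* u n)}) m≡m')
        denominator-cong = pos-+-cong (pos-*-cong (≡ᶻ-refl {x = + a n}) m≡m') (≡ᶻ-refl {x = + u n})

      map₂-level-injective : ∀ {n} → 1 ≤ n → ∀ {m m'} → UnitMod p (+ m) → UnitMod p (+ m') →
                             + map₂-level n m ≡ᶻ + map₂-level n m' [mod p ^ n ] → + m ≡ᶻ + m' [mod p ^ n ]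
      map₂-level-injective {n} 1≤n {m} {m'} m-unit m'-unit map₂-eq =
        map₂-injective-mod {a = + a n} {u = + u n}
          {d' = + invMod (denominator n m) (p ^ n)} {e' = + invMod (denominator n m') (p ^ n)}
          (denominator-inverse 1≤n m) (denominator-inverse 1≤n m') (unitMod-^ h-unit n)
          (≡.subst₂ (λ s t → s ≡ᶻ t [mod p ^ n ]) (map₂-level-ℤ n m) (map₂-level-ℤ n m') map₂-eq)
        where
        h-unit : UnitMod p (+ a n * (+ a n * + m * + m' + + u n * (+ m + + m')) + + 2 * + u n * + u n)
        h-unit = unit-resp-≈ (≡ᶻ-sym (a*t+s≡s 1≤n _ _)) (∙-unit (∙-unit 2-unit (uₙ-unit 1≤n)) (uₙ-unit 1≤n))

      map₂-descends : ∀ {i} → 1 ≤ i → DescendsToBijection p i (map₂ p a u)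
      map₂-descends 1≤i =
        levelwise-descends 1≤i map₂-level map₂-IsZp map₂-level-unit (map₂-level-cong 1≤i) (map₂-level-injective 1≤i)

lemma5p2 : (p : ℕ) → Prime p → p ≢ 2 → (i : ℕ) → 1 ≤ i →
    (a b u : Seq) → InPZp p a → InPZp p b → IsUnit p u →
    DescendsToBijection p i (map₁ p a) × DescendsToBijection p i (map₂ p a u)
lemma5p2 p p-prime p≢2 i 1≤i a _ u a∈pℤₚ _ u-unit =
  map₁-descends 1<p a a∈pℤₚ 1≤i , map₂-descends 1<p a a∈pℤₚ u u-unit 2-unit 1≤i
  where
  1<p : 1 < p
  1<p = ℕ.nonTrivial⇒n>1 p {{prime⇒nonTrivial p-prime}}
  2-unit : UnitMod p (+ 2)
  2-unit = coprime⇒unitMod {{prime⇒nonZero p-prime}}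
             (Coprime.sym (Coprime.prime⇒coprime p-prime (ℕ.≤∧≢⇒< 1<p (p≢2 ∘ ≡.sym))))
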